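{- Let $\mathcal{M}$ be a concurrent epistemic game model, $C$ a coalition, $s_C$ a positional strategy for $C$, and let $s$ be a strategy profile whose restriction to $C$ is $s_C$, and $\lambda\in\mathrm{out\_plays}(\lambda[0],s)$. Suppose that the set $s_C(\mathrm{St})\subseteq\mathrm{Act}^C$ of values of $s_C$ is finite and that for every $\alpha_C$ the set $s_C^{ -1}(\alpha_C)\subseteq\mathrm{St}$ is propositionally definable. Then there is a proposition-action strategy $RS$ for $C$ that is complete at $\lambda[0]$ such that $\langle 0,\lambda,s\rangle\vDash[C\,\mathrm{perf}]RS$.
   Context: A concurrent epistemic game model (CEGM) is $\mathcal{M}=(\mathrm{Ag},\mathrm{St},\{\sim_i\}_{i\in\mathrm{Ag}},\mathrm{Act},\mathrm{act},\mathrm{out},L)$ where $\mathrm{Ag}=\{1,\ldots,K\}$ is a finite nonempty set of agents (subsets are coalitions), $\mathrm{St}$ a nonempty set of states, $\mathrm{Act}$ a nonempty set of action types, $\mathrm{act}(i,q)\subseteq\mathrm{Act}$ a nonempty set of actions available to $i$ at $q$, $\mathrm{act}(q)=\prod_i\mathrm{act}(i,q)$, $\mathrm{out}(q,\alpha)\in\mathrm{St}$ for $\alpha\in\mathrm{act}(q)$, with at most one $\alpha\in\mathrm{act}(q)$ satisfying $\mathrm{out}(q,\alpha)=q'$ for any $q,q'$; $L:\mathrm{St}\to\mathcal{P}(\mathit{Prop})$ a labeling; each $\sim_i$ an equivalence relation on $\mathrm{St}$ with $q\sim_iq'\Rightarrow\mathrm{act}(i,q)=\mathrm{act}(i,q')$.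 A play is $\lambda=q_0q_1\cdots$ with $q_{k+1}=\mathrm{out}(q_k,\alpha)$ for some $\alpha\in\mathrm{act}(q_k)$; $\lambda[k]=q_k$, history $\lambda[0,k]=q_0\cdots q_k$. A (perfect recall) strategy for $i$ maps each history $\lambda[0,k]$ into $\mathrm{act}(i,\lambda[k])$. A positional strategy for $i$ is a map $q\mapsto s_i(q)\in\mathrm{act}(i,q)$, identified with the perfect recall strategy $\lambda[0,k]\mapsto s_i(\lambda[k])$; a positional strategy $s_C$ for $C$ gives $s_C(q)=(s_C(i)(q))_{i\in C}\in\mathrm{Act}^C$. A coalitional strategy $s_C$ assigns a strategy to each $i\in C$; $s_C(h)=(s_C(i)(h))_{i\in C}$. A strategy profile is a coalitional strategy for $\mathrm{Ag}$; $s_C$ is its restriction to $C$; $s'\sqsupseteq s_C$ means $s'(i)=s_C(i)$ for $i\in C$. $\mathrm{out\_plays}(\lambda[0,k],s_C)$ is the set of plays $\lambda'$ with $\lambda'[0,k]=\lambda[0,k]$ such that for every $l\ge k$ there is $\alpha\in\mathrm{act}(\lambda'[l])$ with $\alpha_i=s_C(i)(\lambda'[0,l])$ for $i\in C$ and $\lambda'[l+1]=\mathrm{out}(\lambda'[l],\alpha)$. Language: $\varphi::=p\mid\alpha_C\mid\varphi\wedge\varphi\mid\neg\varphi\mid\mathsf{X}\varphi\mid\mathsf{G}\varphi\mid\Box\varphi\mid[C\,\mathrm{sstit}]\varphi\mid K_i\varphi$, $\Diamond=\neg\Box\neg$. Evaluation points $\langle k,\lambda,s\rangle$: $s$ a profile,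 $\lambda\in\mathrm{out\_plays}(\lambda[0],s)$, $k\ge0$. Clauses: $p$ iff $p\in L(\lambda[k])$; $\alpha_C$ iff $s_C(\lambda[0,k])=\alpha_C$; $\mathsf{X}\varphi$ iff $\varphi$ at $\langle k+1,\lambda,s\rangle$; $\mathsf{G}\varphi$ iff $\varphi$ at $\langle l,\lambda,s\rangle$ for all $l\ge k$; $\Box\varphi$ iff $\varphi$ at $\langle k,\lambda',s'\rangle$ for every profile $s'$ and $\lambda'\in\mathrm{out\_plays}(\lambda[0,k],s')$; $[C\,\mathrm{sstit}]\varphi$ iff $\varphi$ at $\langle k,\lambda',s'\rangle$ for every $s'\sqsupseteq s_C$ and $\lambda'\in\mathrm{out\_plays}(\lambda[0,k],s')$; $K_i\varphi$ iff $\varphi$ at $\langle k,\lambda',s'\rangle$ for all $s'$ and $\lambda'$ with $\lambda'[l]\sim_i\lambda[l]$ for all $l\le k$. $\Box$-formulas depend only on the history, written $\lambda[0,k]\vDash\varphi$. A set $X\subseteq\mathrm{St}$ is propositionally definable if some propositional formula $\xi$ (built from letters by $\wedge,\neg$) holds at exactly the states in $X$. A rule-based strategy is a finite set $RS=\{c_1\mapsto e_1,\ldots,c_N\mapsto e_N\}$ of pairs of formulas. $[C\,\mathrm{acc}]RS:=[C\,\mathrm{sstit}]\bigwedge_n(c_n\to[C\,\mathrm{sstit}]e_n)$, $[C\,\mathrm{perf}]RS:=[C\,\mathrm{sstit}]\mathsf{G}[C\,\mathrm{acc}]RS$. A proposition-action strategy for $C$ has propositional conditions and effects of the form $\alpha_C\in\mathrm{Act}^C$.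 $RS$ is complete at $\lambda[0,k]$ if $\lambda[0,k]\vDash\Box\mathsf{G}\bigvee_nc_n$. -}

module Defs where

open import Data.Nat using (ℕ; zero; suc; _≤_)
open import Data.Fin using (Fin)
open import Data.Fin.Subset using (Subset; _∈_) renaming (⊤ to Full)
open import Data.Bool using (Bool; true)
open import Data.Product using (Σ; _×_; _,_; proj₁; proj₂; ∃)
open import Data.List using (List; []; _∷_)
open import Data.List.NonEmpty using (List⁺; _∷_; head; toList; foldr₁; map)
open import Relation.Binary.PropositionalEquality using (_≡_)
open import Relation.Binary.Structures using (IsEquivalence)
open import Relation.Nullary using (¬_)

record CEGM (n : ℕ) : Set₁ where
  field
    Prop      : Set
    St        : Set
    someState : St
    Act       : Set
    someAct   : Act
    act       : Fin (suc n) → St → Act → Set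
    act-nonempty : ∀ i q → Σ Act (act i q)
    out       : St → (Fin (suc n) → Act) → St     -- out(q, α); only used for α ∈ act(q)
    out-unique : ∀ q (α β : Fin (suc n) → Act)
               → (∀ i → act i q (α i)) → (∀ i → act i q (β i))
               → out q α ≡ out q β → ∀ i → α i ≡ β i
    L         : St → Prop → Bool
    sim       : Fin (suc n) → St → St → Set
    sim-equiv : ∀ i → IsEquivalence (sim i)
    sim-act   : ∀ i q q' → sim i q q' → ∀ a
              → (act i q a → act i q' a) × (act i q' a → act i q a)

module _ {n : ℕ} (M : CEGM n) where
  open CEGM M

  Ag : Set
  Ag = Fin (suc n)

  Play : Set
  Play = ℕ → St

  IsPlay : Play → Set
  IsPlay ρ = ∀ k → Σ (Ag → Act) λ α → (∀ i → act i (ρ k) (α i)) × ρ (suc k) ≡ out (ρ k) α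

  -- Histories q0 ⋯ qk, stored in REVERSE order: head = current state qk.
  History : Set
  History = List⁺ St

  prefix : Play → ℕ → History
  prefix ρ zero    = ρ zero ∷ []
  prefix ρ (suc k) = ρ (suc k) ∷ toList (prefix ρ k)

  Strategy : Ag → Set
  Strategy i = (h : History) → Σ Act (act i (head h))

  Profile : Set
  Profile = (i : Ag) → Strategy i

  CoalStrategy : Subset (suc n) → Set
  CoalStrategy C = (i : Ag) → i ∈ C → Strategy i

  ActC : Subset (suc n) → Set
  ActC C = (i : Ag) → i ∈ C → Act

  SameAct : (C : Subset (suc n)) → ActC C → ActC C → Set
  SameAct C α β = ∀ i (p : i ∈ C) → α i p ≡ β i p

  OutPlays : Play → ℕ → (C : Subset (suc n)) → CoalStrategy C → Play → Set
  OutPlays ρ k C sC ρ' =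
    IsPlay ρ'
    × (∀ l → l ≤ k → ρ' l ≡ ρ l)
    × (∀ l → k ≤ l → Σ (Ag → Act) λ α →
          (∀ i → act i (ρ' l) (α i))
        × (∀ i (p : i ∈ C) → α i ≡ proj₁ (sC i p (prefix ρ' l)))
        × ρ' (suc l) ≡ out (ρ' l) α)

  OutPlaysP : Play → ℕ → Profile → Play → Set
  OutPlaysP ρ k s = OutPlays ρ k Full (λ i _ → s i)

  Extends : Profile → (C : Subset (suc n)) → CoalStrategy C → Set
  Extends s' C sC = ∀ i (p : i ∈ C) (h : History) → proj₁ (s' i h) ≡ proj₁ (sC i p h)

  restrict : Profile → (C : Subset (suc n)) → CoalStrategy C
  restrict s C i _ = s i

  infixr 6 _∧'_
  infix 7 ¬'_
  infixr 6 _∧ₚ_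
  infix 7 ¬ₚ_
  data Form : Set where
    atom  : Prop → Form
    does  : (C : Subset (suc n)) → ActC C → Form
    _∧'_  : Form → Form → Form
    ¬'_   : Form → Form
    X     : Form → Form
    G     : Form → Form
    □     : Form → Form
    sstit : Subset (suc n) → Form → Form
    Kn    : Ag → Form → Form

  Sat : ℕ → Play → Profile → Form → Set
  Sat k ρ s (atom p)    = L (ρ k) p ≡ true
  Sat k ρ s (does C α)  = ∀ i (p : i ∈ C) → proj₁ (s i (prefix ρ k)) ≡ α i p
  Sat k ρ s (φ ∧' ψ)    = Sat k ρ s φ × Sat k ρ s ψ
  Sat k ρ s (¬' φ)      = ¬ Sat k ρ s φ
  Sat k ρ s (X φ)       = Sat (suc k) ρ s φ
  Sat k ρ s (G φ)       = ∀ l → k ≤ l → Sat l ρ s φ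
  Sat k ρ s (□ φ)       = ∀ (s' : Profile) (ρ' : Play) → OutPlaysP ρ k s' ρ' → Sat k ρ' s' φ
  Sat k ρ s (sstit C φ) = ∀ (s' : Profile) → Extends s' C (restrict s C)
                          → ∀ (ρ' : Play) → OutPlaysP ρ k s' ρ' → Sat k ρ' s' φ
  Sat k ρ s (Kn i φ)    = ∀ (s' : Profile) (ρ' : Play) → OutPlaysP ρ' 0 s' ρ'
                          → (∀ l → l ≤ k → sim i (ρ' l) (ρ l)) → Sat k ρ' s' φ

  _⇒'_ : Form → Form → Form
  φ ⇒' ψ = ¬' (φ ∧' ¬' ψ)

  _∨'_ : Form → Form → Form
  φ ∨' ψ = ¬' (¬' φ ∧' ¬' ψ)

  ⋀ : List⁺ Form → Form
  ⋀ = foldr₁ _∧'_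

  ⋁ : List⁺ Form → Form
  ⋁ = foldr₁ _∨'_

  RuleStrategy : Set
  RuleStrategy = List⁺ (Form × Form)

  acc : Subset (suc n) → RuleStrategy → Form
  acc C RS = sstit C (⋀ (map (λ ce → proj₁ ce ⇒' sstit C (proj₂ ce)) RS))

  perf : Subset (suc n) → RuleStrategy → Form
  perf C RS = sstit C (G (acc C RS))

  -- completeness at λ[0,k]: λ[0,k] ⊨ □ G ⋁ c_n  (a □-formula, so it depends
  -- only on the history; evaluated at ⟨k, ρ, s⟩)
  Complete : RuleStrategy → ℕ → Play → Profile → Set
  Complete RS k ρ s = Sat k ρ s (□ (G (⋁ (map proj₁ RS))))

  data PForm : Set where
    patom : Prop → PForm
    _∧ₚ_  : PForm → PForm → PForm
    ¬ₚ_   : PForm → PForm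

  embed : PForm → Form
  embed (patom p) = atom p
  embed (φ ∧ₚ ψ)  = embed φ ∧' embed ψ
  embed (¬ₚ φ)    = ¬' embed φ

  HoldsAt : PForm → St → Set
  HoldsAt (patom p) q = L q p ≡ true
  HoldsAt (φ ∧ₚ ψ)  q = HoldsAt φ q × HoldsAt ψ q
  HoldsAt (¬ₚ φ)    q = ¬ HoldsAt φ q

  PropDefinable : (St → Set) → Set
  PropDefinable Y = Σ PForm λ ξ → ∀ q → (HoldsAt ξ q → Y q) × (Y q → HoldsAt ξ q)

  PAStrategy : Subset (suc n) → Set
  PAStrategy C = List⁺ (PForm × ActC C)

  toRS : (C : Subset (suc n)) → PAStrategy C → RuleStrategy
  toRS C = map (λ ce → embed (proj₁ ce) , does C (proj₂ ce))

  PosStrategy : Subset (suc n) → Set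
  PosStrategy C = (i : Ag) → i ∈ C → (q : St) → Σ Act (act i q)

  posVal : (C : Subset (suc n)) → PosStrategy C → St → ActC C
  posVal C sC q i p = proj₁ (sC i p q)

  -- the restriction of the profile s to C is (the perfect recall version of) sC
  RestrictsTo : Profile → (C : Subset (suc n)) → PosStrategy C → Set
  RestrictsTo s C sC = ∀ i (p : i ∈ C) (h : History) → proj₁ (s i h) ≡ proj₁ (sC i p (head h))

  -- s_C(St) ⊆ Act^C is finite: enumerated (up to pointwise equality) by some Fin m → Act^C
  FiniteImage : (C : Subset (suc n)) → PosStrategy C → Set
  FiniteImage C sC = Σ ℕ λ m → Σ (Fin m → ActC C) λ f →
      (∀ q → ∃ λ j → SameAct C (posVal C sC q) (f j))
    × (∀ j → ∃ λ q → SameAct C (posVal C sC q) (f j))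

-- Take one rule ξ_α ↦ α_C per value α of s_C, with ξ_α defining s_C⁻¹(α); finiteness
-- of the image makes this a finite rule set, and it is complete because every state
-- lies in some preimage.  Each rule is sound: where ξ_α holds, s_C prescribes α, and
-- since s_C is positional every profile extending it plays α there whatever the
-- history.  Extending a profile that extends s_C again extends s_C, so soundness
-- survives the nested [C sstit] operators of [C perf].
module Submission where

open import Defs
open import Data.Nat using (ℕ; zero; suc)
open import Data.Nat.Properties using (≤-refl)
open import Data.Fin using (Fin; zero; suc)
open import Data.Fin.Subset using (Subset)
open import Data.Product using (Σ; ∃; _×_; _,_; proj₁; proj₂)
open import Data.List as List using ([]; _∷_)
open import Data.List.NonEmpty as List⁺ using (List⁺; _∷_)
open import Data.List.Relation.Unary.All as All using (All; []; _∷_)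
open import Data.List.Relation.Unary.Any as Any using (Any; here; there)
import Data.List.Relation.Unary.All.Properties as All
import Data.List.Relation.Unary.Any.Properties as Any
open import Function using (_∘_)
open import Relation.Binary.PropositionalEquality using (_≡_; refl; sym; trans; cong; subst)
open Relation.Binary.PropositionalEquality.≡-Reasoning

tabulate⁺ : ∀ {A : Set} {m} → (Fin (suc m) → A) → List⁺ A
tabulate⁺ f = f zero ∷ List.tabulate (f ∘ suc)

module _ {n : ℕ} (M : CEGM n) where
  open CEGM M

  ⋀-intro : ∀ {k ρ s} (φs : List⁺ (Form M)) →
            All (Sat M k ρ s) (List⁺.toList φs) → Sat M k ρ s (⋀ M φs)
  ⋀-intro (φ ∷ [])     (p ∷ [])  = p
  ⋀-intro (φ ∷ ψ ∷ φs) (p ∷ ps) = p , ⋀-intro (ψ ∷ φs) ps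

  ⋁-intro : ∀ {k ρ s} (φs : List⁺ (Form M)) →
            Any (Sat M k ρ s) (List⁺.toList φs) → Sat M k ρ s (⋁ M φs)
  ⋁-intro (φ ∷ [])     (here p)  = p
  ⋁-intro (φ ∷ ψ ∷ φs) (here p)  = λ (¬p , _) → ¬p p
  ⋁-intro (φ ∷ ψ ∷ φs) (there p) = λ (_ , ¬q) → ¬q (⋁-intro (ψ ∷ φs) p)

  embed-sound    : ∀ {k ρ s} ξ → Sat M k ρ s (embed M ξ) → HoldsAt M ξ (ρ k)
  embed-complete : ∀ {k ρ s} ξ → HoldsAt M ξ (ρ k) → Sat M k ρ s (embed M ξ)

  embed-sound (patom p) h       = h
  embed-sound (φ ∧ₚ ψ)  (a , b) = embed-sound φ a , embed-sound ψ b
  embed-sound (¬ₚ φ)    h       = h ∘ embed-complete φ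

  embed-complete (patom p) h       = h
  embed-complete (φ ∧ₚ ψ)  (a , b) = embed-complete φ a , embed-complete ψ b
  embed-complete (¬ₚ φ)    h       = h ∘ embed-sound φ

  head-prefix : ∀ (ρ : Play M) k → List⁺.head (prefix M ρ k) ≡ ρ k
  head-prefix ρ zero    = refl
  head-prefix ρ (suc k) = refl

  SoundRule : ∀ {C} → PosStrategy M C → PForm M × ActC M C → Set
  SoundRule {C} sC (ξ , α) = ∀ q → HoldsAt M ξ q → SameAct M C (posVal M C sC q) α

  module _ {C : Subset (suc n)} {sC : PosStrategy M C} where

    restrictsTo-extends : ∀ s s' → RestrictsTo M s C sC →
                          Extends M s' C (restrict M s C) → RestrictsTo M s' C sC
    restrictsTo-extends s s' r e i p h = trans (e i p h) (r i p h)

    does-positional : ∀ {s k ρ α} → RestrictsTo M s C sC →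
                      SameAct M C (posVal M C sC (ρ k)) α → Sat M k ρ s (does C α)
    does-positional {s} {k} {ρ} {α} r eq i p = begin
      proj₁ (s i (prefix M ρ k))                  ≡⟨ r i p (prefix M ρ k) ⟩
      proj₁ (sC i p (List⁺.head (prefix M ρ k)))  ≡⟨ cong (λ q → proj₁ (sC i p q)) (head-prefix ρ k) ⟩
      proj₁ (sC i p (ρ k))                        ≡⟨ eq i p ⟩
      α i p                                       ∎

    sstit-does-positional : ∀ {s k ρ α} → RestrictsTo M s C sC →
                            SameAct M C (posVal M C sC (ρ k)) α → Sat M k ρ s (sstit C (does C α))
    sstit-does-positional {s} {k} {α = α} r eq s' e ρ' (_ , agree , _) =
      does-positional {s'} (restrictsTo-extends s s' r e)
        (subst (λ q → SameAct M C (posVal M C sC q) α) (sym (agree k ≤-refl)) eq)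

    rule-holds : ∀ {s k ρ} → RestrictsTo M s C sC → ∀ {r} → SoundRule sC r →
                 Sat M k ρ s (_⇒'_ M (embed M (proj₁ r)) (sstit C (does C (proj₂ r))))
    rule-holds {s} {k} {ρ} r {ξ , _} sound (h , ¬does) =
      ¬does (sstit-does-positional {s} {k} {ρ} r (sound (ρ k) (embed-sound ξ h)))

    acc-holds : ∀ {s k ρ} → RestrictsTo M s C sC → (RS : PAStrategy M C) →
                All (SoundRule sC) (List⁺.toList RS) → Sat M k ρ s (acc M C (toRS M C RS))
    acc-holds {s} r RS sound s' e ρ' _ =
      ⋀-intro _ (All.map⁺ (All.map⁺ (All.map (rule-holds {s'} {ρ = ρ'} r') sound)))
      where r' = restrictsTo-extends s s' r e

    perf-holds : ∀ {s k ρ} → RestrictsTo M s C sC → (RS : PAStrategy M C) →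
                 All (SoundRule sC) (List⁺.toList RS) → Sat M k ρ s (perf M C (toRS M C RS))
    perf-holds {s} r RS sound s' e ρ' _ l _ =
      acc-holds {s'} {l} {ρ'} (restrictsTo-extends s s' r e) RS sound

  Exhaustive : ∀ {C} → PAStrategy M C → Set
  Exhaustive RS = ∀ q → Any (λ r → HoldsAt M (proj₁ r) q) (List⁺.toList RS)

  exhaustive⇒complete : ∀ {C k ρ s} (RS : PAStrategy M C) → Exhaustive RS →
                        Complete M (toRS M C RS) k ρ s
  exhaustive⇒complete RS cover s' ρ' _ l _ =
    ⋁-intro _ (Any.map⁺ (Any.map⁺ (Any.map (embed-complete _) (cover (ρ' l)))))

  finiteImage⇒cover : ∀ {C sC} → FiniteImage M C sC →
    Σ ℕ λ m → Σ (Fin (suc m) → ActC M C) λ f → ∀ q → ∃ λ j → SameAct M C (posVal M C sC q) (f j)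
  finiteImage⇒cover (zero , _ , cover , _) with cover someState
  ... | () , _
  finiteImage⇒cover (suc m , f , cover , _) = m , f , cover

proposition3 : ∀ {n} (M : CEGM n) (C : Subset (suc n)) (sC : PosStrategy M C)
    (s : Profile M) → RestrictsTo M s C sC
    → (ρ : Play M) → OutPlaysP M ρ 0 s ρ
    → FiniteImage M C sC
    → (∀ (α : ActC M C) → PropDefinable M (λ q → SameAct M C (posVal M C sC q) α))
    → Σ (PAStrategy M C) (λ RS →
        Complete M (toRS M C RS) 0 ρ s × Sat M 0 ρ s (perf M C (toRS M C RS)))
proposition3 M C sC s r ρ _ finite definable with finiteImage⇒cover M {sC = sC} finite
... | m , f , cover =
  RS , exhaustive⇒complete M {ρ = ρ} {s} RS exhaustive , perf-holds M {sC = sC} {s} r RS sound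
  where
  rule : Fin (suc m) → PForm M × ActC M C
  rule j = proj₁ (definable (f j)) , f j

  RS : PAStrategy M C
  RS = tabulate⁺ rule

  sound : All (SoundRule M sC) (List⁺.toList RS)
  sound = All.tabulate⁺ {f = rule} λ j q → proj₁ (proj₂ (definable (f j)) q)

  exhaustive : Exhaustive M RS
  exhaustive q = let j , q∈f⁻¹j = cover q in
    Any.tabulate⁺ {f = rule} j (proj₂ (proj₂ (definable (f j)) q) q∈f⁻¹j)
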